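{- Let $\Gamma$ be any set of sequents and let $\Gamma^\exists=\{A^\exists\Rightarrow B^\exists \mid A\Rightarrow B\in\Gamma\}$, and assume $\mathbb N\models\Gamma^\exists$ (i.e. for each $C\Rightarrow D$ in $\Gamma^\exists$, the universal closure of $C\to D$ is true in the standard model $\mathbb N$). If a function $f:\mathbb N^n\to\mathbb N$ is defined by a formula $A(\mathbf x,y)$ in the theory $\mathbf{BA}+\Gamma^\exists$, then $f$ is also defined in $\mathbf{BA}+\Gamma^\exists$ by the $\exists_1^+$ formula $A^\exists(\mathbf x,y)$. Consequently $\mathrm{PT}(\mathbf{BA}+\Gamma^\exists)=\mathrm{PR}(\mathbf{BA}+\Gamma^\exists)$.
   Context: Language and formulas: the arithmetic language is $\mathcal L=\{0,S,+,\cdot\}$; $s<t$ abbreviates $\exists x(s+Sx=t)$ ($x$ fresh), $s\le t$ abbreviates $s<t\lor s=t$. Formulas of basic logic are built from atomic formulas (equations $s=t$, $\top$, $\bot$) using $\land,\lor,\exists x$, and the universal-implication former: if $A,B$ are formulas and $\mathbf x$ is a finite (possibly empty) sequence of distinct variables then $\forall\mathbf x(A\to B)$ is a formula (for empty $\mathbf x$ it is the implication $A\to B$; $\neg A$ means $A\to\bot$). Theories prove sequents $A\Rightarrow B$; "$T\vdash A$" means $T\vdash\top\Rightarrow A$. Basic Predicate Calculus $\mathbf{BQC}$ has axioms: $A\Rightarrow A$; $A\Rightarrow\top$; $\bot\Rightarrow A$; $A\land(B\lor C)\Rightarrow(A\land B)\lor(A\land C)$; $A\land\exists xB\Rightarrow\exists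 x(A\land B)$ ($x$ not free in $A$); $\top\Rightarrow x=x$; $x=y\land A\Rightarrow A[x/y]$ ($A$ atomic); $\forall\mathbf x(A\to B)\land\forall\mathbf x(B\to C)\Rightarrow\forall\mathbf x(A\to C)$; $\forall\mathbf x(A\to B)\land\forall\mathbf x(A\to C)\Rightarrow\forall\mathbf x(A\to B\land C)$; $\forall\mathbf x(B\to A)\land\forall\mathbf x(C\to A)\Rightarrow\forall\mathbf x(B\lor C\to A)$; $\forall\mathbf x(A\to B)\Rightarrow\forall\mathbf x(A[\mathbf x/\mathbf t]\to B[\mathbf x/\mathbf t])$; $\forall\mathbf x(A\to B)\Rightarrow\forall\mathbf y(A\to B)$ (no variable of $\mathbf y$ free on the left); $\forall\mathbf y x(B\to A)\Rightarrow\forall\mathbf y(\exists xB\to A)$ ($x$ not free in $A$); and rules: from $A\Rightarrow B$, $B\Rightarrow C$ infer $A\Rightarrow C$; $A\Rightarrow B\land C$ iff both $A\Rightarrow B$ and $A\Rightarrow C$; $B\lor C\Rightarrow A$ iff both $B\Rightarrow A$ and $C\Rightarrow A$; from $A\Rightarrow B$ infer $A[\mathbf x/\mathbf t]\Rightarrow B[\mathbf x/\mathbf t]$; $\exists xB\Rightarrow A$ iff $B\Rightarrow A$ ($x$ not free in $A$); from $A\land B\Rightarrow C$ infer $A\Rightarrow\forall\mathbf x(B\to C)$ (no variable of $\mathbf x$ free in $A$); substitutions are capture-free. Basic Arithmetic $\mathbf{BA}$ is $\mathbf{BQC}$ plus: $Sx=0\Rightarrow\bot$; $Sx=Sy\Rightarrow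 x=y$; $x+0=x$; $x+Sy=S(x+y)$; $x\cdot0=0$; $x\cdot Sy=x\cdot y+x$; the induction axiom schema $\forall\mathbf y x(A\to A[x/Sx])\Rightarrow\forall\mathbf y x(A[x/0]\to A)$; and the induction rule: from $A\Rightarrow A[x/Sx]$ infer $A[x/0]\Rightarrow A$. $\mathbf{BA}+\Gamma^\exists$ is $\mathbf{BA}$ with the sequents of $\Gamma^\exists$ added as axioms. Positive part: $A^\exists$ is defined by $A^\exists=A$ for atomic $A$; $(A'\circ A'')^\exists=A'^\exists\circ A''^\exists$ for $\circ\in\{\land,\lor\}$; $(\exists u A')^\exists=\exists u A'^\exists$; $(\forall\mathbf u(A'\to A''))^\exists=\top$. Classes: $\Delta_0$ is the smallest class containing atomic formulas, closed under $\land,\lor,\to$ and bounded quantification $\exists x(x<s\land A)$, $\forall x(x<s\to A)$; $\Sigma_1$ formulas are $\exists\mathbf xA$ with $A\in\Delta_0$; $\exists_1^+$ formulas are $\exists\mathbf xA$ with $A$ quantifier-free and containing no $\to$ (and hence no $\forall$). Definability: a formula $A(\mathbf x,y)$ defines $f:\mathbb N^n\to\mathbb N$ in $\mathbb N$ if for all $\mathbf a,b$, $\mathbb N\models A(\mathbf a,b)$ iff $f(\mathbf a)=b$. Its existence sequent is $\top\Rightarrow\exists yA(\mathbf x,y)$ and its uniqueness sequent is $A(\mathbf x,u)\land A(\mathbf x,v)\Rightarrow u=v$ ($u,v$ fresh). $A$ defines $f$ in a theory $T$ if it defines $f$ in $\mathbb N$ and $T$ proves its existence and uniqueness sequents. $\mathrm{PT}(T)$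 is the set of functions defined in $T$ by some formula (provably total), and $\mathrm{PR}(T)$ the set of functions defined in $T$ by some $\Sigma_1$ formula (provably recursive). -}

module Defs where

open import Data.Nat using (ℕ; zero; suc; _+_; _*_; _≤_; _<_; _≡ᵇ_)
open import Data.Vec using (Vec; []; _∷_)
open import Data.Product using (Σ; _×_; _,_)
open import Data.Sum using (_⊎_)
open import Data.Unit using (⊤)
open import Data.Empty using (⊥)
open import Data.Bool using (if_then_else_)
open import Relation.Nullary using (¬_)
open import Relation.Binary.PropositionalEquality using (_≡_)

-- Syntax of the arithmetic language {0,S,+,·}, de Bruijn indices.
-- Formulas are thus taken up to α-equivalence and all substitutions
-- are automatically capture-free.

data Tm : Set where
  var  : ℕ → Tm
  `0   : Tm
  `S   : Tm → Tm
  _`+_ : Tm → Tm → Tm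
  _`·_ : Tm → Tm → Tm

-- ∀[ k ] A ⊃ B is the universal implication ∀x₁…x_k (A → B);
-- in A and B the indices 0..k-1 are the bound variables and
-- index k + j refers to the outer variable j.
data Fm : Set where
  _≐_     : Tm → Tm → Fm
  ⊤'      : Fm
  ⊥'      : Fm
  _∧'_    : Fm → Fm → Fm
  _∨'_    : Fm → Fm → Fm
  ∃'      : Fm → Fm
  ∀[_]_⊃_ : ℕ → Fm → Fm → Fm

infix  8 _≐_
infixr 7 _∧'_
infixr 6 _∨'_

Sub : Set
Sub = ℕ → Tm

substT : Sub → Tm → Tm
substT σ (var i)  = σ i
substT σ `0       = `0
substT σ (`S t)   = `S (substT σ t)
substT σ (t `+ u) = substT σ t `+ substT σ u
substT σ (t `· u) = substT σ t `· substT σ u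

shT : Tm → Tm
shT = substT (λ i → var (suc i))

lift : Sub → Sub
lift σ zero    = var zero
lift σ (suc i) = shT (σ i)

liftN : ℕ → Sub → Sub
liftN zero    σ = σ
liftN (suc k) σ = lift (liftN k σ)

sub : Sub → Fm → Fm
sub σ (t ≐ u)         = substT σ t ≐ substT σ u
sub σ ⊤'              = ⊤'
sub σ ⊥'              = ⊥'
sub σ (A ∧' B)        = sub σ A ∧' sub σ B
sub σ (A ∨' B)        = sub σ A ∨' sub σ B
sub σ (∃' A)          = ∃' (sub (lift σ) A)
sub σ (∀[ k ] A ⊃ B)  = ∀[ k ] sub (liftN k σ) A ⊃ sub (liftN k σ) B

wkN : ℕ → Fm → Fm
wkN k = sub (λ i → var (k + i))

wk : Fm → Fm
wk = wkN 1

single : ℕ → Tm → Sub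
single i t j = if j ≡ᵇ i then t else var j

OccT : ℕ → Tm → Set
OccT i (var j)  = i ≡ j
OccT i `0       = ⊥
OccT i (`S t)   = OccT i t
OccT i (t `+ u) = OccT i t ⊎ OccT i u
OccT i (t `· u) = OccT i t ⊎ OccT i u

FreeIn : ℕ → Fm → Set
FreeIn i (t ≐ u)        = OccT i t ⊎ OccT i u
FreeIn i ⊤'             = ⊥
FreeIn i ⊥'             = ⊥
FreeIn i (A ∧' B)       = FreeIn i A ⊎ FreeIn i B
FreeIn i (A ∨' B)       = FreeIn i A ⊎ FreeIn i B
FreeIn i (∃' A)         = FreeIn (suc i) A
FreeIn i (∀[ k ] A ⊃ B) = FreeIn (k + i) A ⊎ FreeIn (k + i) B

data Atomic : Fm → Set where
  eq  : ∀ t u → Atomic (t ≐ u)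
  top : Atomic ⊤'
  bot : Atomic ⊥'

-- The proof system BA + Ax  (BQC + arithmetic axioms + induction),
-- where Ax is a set of extra sequents.

infix 4 _⊢_⇒_

data _⊢_⇒_ (Ax : Fm → Fm → Set) : Fm → Fm → Set where
  ax      : ∀ {A B} → Ax A B → Ax ⊢ A ⇒ B
  idA     : ∀ {A} → Ax ⊢ A ⇒ A
  topA    : ∀ {A} → Ax ⊢ A ⇒ ⊤'
  botA    : ∀ {A} → Ax ⊢ ⊥' ⇒ A
  distA   : ∀ {A B C} → Ax ⊢ A ∧' (B ∨' C) ⇒ (A ∧' B) ∨' (A ∧' C)
  ∃distA  : ∀ {A B} → Ax ⊢ A ∧' ∃' B ⇒ ∃' (wk A ∧' B)
  eqRefl  : ∀ i → Ax ⊢ ⊤' ⇒ var i ≐ var i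
  eqSub   : ∀ i j {A} → Atomic A →
            Ax ⊢ (var i ≐ var j) ∧' A ⇒ sub (single i (var j)) A
  ∀trans  : ∀ {k A B C} →
            Ax ⊢ (∀[ k ] A ⊃ B) ∧' (∀[ k ] B ⊃ C) ⇒ ∀[ k ] A ⊃ C
  ∀conj   : ∀ {k A B C} →
            Ax ⊢ (∀[ k ] A ⊃ B) ∧' (∀[ k ] A ⊃ C) ⇒ ∀[ k ] A ⊃ (B ∧' C)
  ∀disj   : ∀ {k A B C} →
            Ax ⊢ (∀[ k ] B ⊃ A) ∧' (∀[ k ] C ⊃ A) ⇒ ∀[ k ] (B ∨' C) ⊃ A
  -- ∀x(A→B) ⇒ ∀x(A[x/t]→B[x/t]) : σ replaces the bound variables only
  ∀subst  : ∀ {k A B} (σ : Sub) → (∀ j → σ (k + j) ≡ var (k + j)) →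
            Ax ⊢ ∀[ k ] A ⊃ B ⇒ ∀[ k ] sub σ A ⊃ sub σ B
  -- ∀x(A→B) ⇒ ∀y(A→B), no variable of y free on the left:
  -- each bound variable either stays bound (as some y) or becomes a
  -- free variable not free on the left; distinct variables stay distinct.
  ∀rename : ∀ {k m A B} (ρ : ℕ → ℕ) →
            (∀ j → ρ (k + j) ≡ m + j) →
            (∀ i → i < k → (ρ i < m) ⊎
               Σ ℕ (λ o → (ρ i ≡ m + o) × ¬ FreeIn o (∀[ k ] A ⊃ B))) →
            (∀ i i' → FreeIn i (∀[ 0 ] A ⊃ B) → FreeIn i' (∀[ 0 ] A ⊃ B) →
               ρ i ≡ ρ i' → i ≡ i') →
            Ax ⊢ ∀[ k ] A ⊃ B ⇒ ∀[ m ] sub (λ i → var (ρ i)) A ⊃ sub (λ i → var (ρ i)) B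
  -- ∀y x(B → A) ⇒ ∀y(∃x B → A), x not free in A  (x is bound index 0)
  ∀∃      : ∀ {k A B} →
            Ax ⊢ ∀[ suc k ] B ⊃ wk A ⇒ ∀[ k ] ∃' B ⊃ A
  cut     : ∀ {A B C} → Ax ⊢ A ⇒ B → Ax ⊢ B ⇒ C → Ax ⊢ A ⇒ C
  ∧I      : ∀ {A B C} → Ax ⊢ A ⇒ B → Ax ⊢ A ⇒ C → Ax ⊢ A ⇒ B ∧' C
  ∧E₁     : ∀ {A B C} → Ax ⊢ A ⇒ B ∧' C → Ax ⊢ A ⇒ B
  ∧E₂     : ∀ {A B C} → Ax ⊢ A ⇒ B ∧' C → Ax ⊢ A ⇒ C
  ∨E      : ∀ {A B C} → Ax ⊢ B ⇒ A → Ax ⊢ C ⇒ A → Ax ⊢ B ∨' C ⇒ A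
  ∨I₁     : ∀ {A B C} → Ax ⊢ B ∨' C ⇒ A → Ax ⊢ B ⇒ A
  ∨I₂     : ∀ {A B C} → Ax ⊢ B ∨' C ⇒ A → Ax ⊢ C ⇒ A
  substR  : ∀ {A B} (σ : Sub) → Ax ⊢ A ⇒ B → Ax ⊢ sub σ A ⇒ sub σ B
  ∃L      : ∀ {A B} → Ax ⊢ B ⇒ wk A → Ax ⊢ ∃' B ⇒ A
  ∃L⁻     : ∀ {A B} → Ax ⊢ ∃' B ⇒ A → Ax ⊢ B ⇒ wk A
  →I      : ∀ {k A B C} → Ax ⊢ wkN k A ∧' B ⇒ C → Ax ⊢ A ⇒ ∀[ k ] B ⊃ C
  sNeq0   : ∀ i → Ax ⊢ `S (var i) ≐ `0 ⇒ ⊥'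
  sInj    : ∀ i j → Ax ⊢ `S (var i) ≐ `S (var j) ⇒ var i ≐ var j
  plus0   : ∀ i → Ax ⊢ ⊤' ⇒ var i `+ `0 ≐ var i
  plusS   : ∀ i j → Ax ⊢ ⊤' ⇒ var i `+ `S (var j) ≐ `S (var i `+ var j)
  times0  : ∀ i → Ax ⊢ ⊤' ⇒ var i `· `0 ≐ `0
  timesS  : ∀ i j → Ax ⊢ ⊤' ⇒ var i `· `S (var j) ≐ (var i `· var j) `+ var i
  -- induction axiom: ∀y x(A → A[x/Sx]) ⇒ ∀y x(A[x/0] → A), x = bound index 0
  indAx   : ∀ {k A} →
            Ax ⊢ ∀[ suc k ] A ⊃ sub (single 0 (`S (var 0))) A
               ⇒ ∀[ suc k ] sub (single 0 `0) A ⊃ A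
  indR    : ∀ i {A} → Ax ⊢ A ⇒ sub (single i (`S (var i))) A →
            Ax ⊢ sub (single i `0) A ⇒ A

pos : Fm → Fm
pos (t ≐ u)        = t ≐ u
pos ⊤'             = ⊤'
pos ⊥'             = ⊥'
pos (A ∧' B)       = pos A ∧' pos B
pos (A ∨' B)       = pos A ∨' pos B
pos (∃' A)         = ∃' (pos A)
pos (∀[ k ] A ⊃ B) = ⊤'

_^∃ : (Fm → Fm → Set) → (Fm → Fm → Set)
(Γ ^∃) C D = Σ Fm (λ A → Σ Fm (λ B → Γ A B × (C ≡ pos A) × (D ≡ pos B)))

data PosEx : Fm → Set where
  atom : ∀ {A} → Atomic A → PosEx A
  and  : ∀ {A B} → PosEx A → PosEx B → PosEx (A ∧' B)
  or   : ∀ {A B} → PosEx A → PosEx B → PosEx (A ∨' B)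
  ex   : ∀ {A} → PosEx A → PosEx (∃' A)

-- classical truth in the standard model ℕ (double-negation reading of ∨, ∃)

Env : Set
Env = ℕ → ℕ

_∷ₑ_ : ℕ → Env → Env
(a ∷ₑ ρ) zero    = a
(a ∷ₑ ρ) (suc i) = ρ i

extV : ∀ {k} → Vec ℕ k → Env → Env
extV []       ρ = ρ
extV (a ∷ v)  ρ = a ∷ₑ extV v ρ

evalT : Env → Tm → ℕ
evalT ρ (var i)  = ρ i
evalT ρ `0       = 0
evalT ρ (`S t)   = suc (evalT ρ t)
evalT ρ (t `+ u) = evalT ρ t + evalT ρ u
evalT ρ (t `· u) = evalT ρ t * evalT ρ u

Sat : Env → Fm → Set
Sat ρ (t ≐ u)        = evalT ρ t ≡ evalT ρ u
Sat ρ ⊤'             = ⊤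
Sat ρ ⊥'             = ⊥
Sat ρ (A ∧' B)       = Sat ρ A × Sat ρ B
Sat ρ (A ∨' B)       = ¬ ¬ (Sat ρ A ⊎ Sat ρ B)
Sat ρ (∃' A)         = ¬ ¬ Σ ℕ (λ a → Sat (a ∷ₑ ρ) A)
Sat ρ (∀[ k ] A ⊃ B) = (v : Vec ℕ k) → Sat (extV v ρ) A → Sat (extV v ρ) B

ℕ⊨ : (Fm → Fm → Set) → Set
ℕ⊨ Ax = ∀ C D → Ax C D → (ρ : Env) → Sat ρ C → Sat ρ D

-- definability.  Convention for A(x,y): y is index 0, x_i is index suc i.
-- In the uniqueness sequent x_i is index i, u is index n, v is index suc n.

uSub : ℕ → Sub
uSub w zero    = var w
uSub w (suc i) = var i

DefinesInℕ : (n : ℕ) → (Vec ℕ n → ℕ) → Fm → Set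
DefinesInℕ n f A = (a : Vec ℕ n) (b : ℕ) (ρ : Env) →
  (Sat (extV (b ∷ a) ρ) A → f a ≡ b) × (f a ≡ b → Sat (extV (b ∷ a) ρ) A)

Defines : (Fm → Fm → Set) → (n : ℕ) → (Vec ℕ n → ℕ) → Fm → Set
Defines Ax n f A =
  (∀ i → FreeIn i A → i ≤ n) ×
  DefinesInℕ n f A ×
  (Ax ⊢ ⊤' ⇒ ∃' A) ×
  (Ax ⊢ sub (uSub n) A ∧' sub (uSub (suc n)) A ⇒ var n ≐ var (suc n))

lt : Tm → Tm → Fm
lt s t = ∃' (shT s `+ `S (var 0) ≐ shT t)

data Δ₀ : Fm → Set where
  atom : ∀ {A} → Atomic A → Δ₀ A
  and  : ∀ {A B} → Δ₀ A → Δ₀ B → Δ₀ (A ∧' B)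
  or   : ∀ {A B} → Δ₀ A → Δ₀ B → Δ₀ (A ∨' B)
  imp  : ∀ {A B} → Δ₀ A → Δ₀ B → Δ₀ (∀[ 0 ] A ⊃ B)
  bex  : ∀ {A} s → Δ₀ A → Δ₀ (∃' (lt (var 0) (shT s) ∧' A))
  ball : ∀ {A} s → Δ₀ A → Δ₀ (∀[ 1 ] lt (var 0) (shT s) ⊃ A)

exN : ℕ → Fm → Fm
exN zero    A = A
exN (suc k) A = ∃' (exN k A)

Σ₁ : Fm → Set
Σ₁ A = Σ ℕ (λ k → Σ Fm (λ B → Δ₀ B × (A ≡ exN k B)))

PT : (Fm → Fm → Set) → (n : ℕ) → (Vec ℕ n → ℕ) → Set
PT Ax n f = Σ Fm (λ A → Defines Ax n f A)

PR : (Fm → Fm → Set) → (n : ℕ) → (Vec ℕ n → ℕ) → Set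
PR Ax n f = Σ Fm (λ A → Σ₁ A × Defines Ax n f A)

-- Taking positive parts commutes with substitution and maps every axiom and
-- rule of BA + Γ^∃ to an instance of itself or to a sequent with conclusion
-- ⊤ (everything involving ∀), so a derivation of A ⇒ B yields one of
-- A^∃ ⇒ B^∃; in particular the existence and uniqueness sequents of a
-- definition A carry over to A^∃.  Over ℕ, A implies A^∃, and positive
-- parts of derivations are sound once Γ^∃ is true; hence the graph of f
-- satisfies A^∃ and the uniqueness sequent forces it to be the whole of
-- A^∃.  Finally, in BQC every positive existential formula is provably
-- equivalent to a prenex ∃-formula with quantifier-free matrix, a Σ₁ formula.
module Submission where

open import Defs
open import Data.Nat using (ℕ; zero; suc; _+_; _*_; _≤_; _<_; s≤s; _≡ᵇ_)
open import Data.Nat.Properties using (suc-injective; +-suc; *-suc; +-comm; +-identityʳ; *-zeroʳ; ≡ᵇ⇒≡; ≡⇒≡ᵇ; _≟_)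
open import Data.Vec using (Vec; []; _∷_)
open import Data.Product using (Σ; _×_; _,_; proj₁; proj₂)
open import Data.Sum using (inj₁; inj₂; [_,_]′)
import Data.Sum as Sum
open import Data.Unit using (tt)
open import Data.Bool using (true; false; T; if_then_else_)
open import Function using (id)
open import Relation.Nullary.Negation using (¬¬-map; Stable)
open import Relation.Nullary.Decidable using (decidable-stable)
open import Relation.Binary.PropositionalEquality
  using (_≡_; _≗_; refl; sym; trans; cong; cong₂; subst; subst₂; module ≡-Reasoning)

private
  variable
    A B C D E P R : Fm
    i j n : ℕ
    ρ ρ' : Env
    σ : Sub

pos-sub : ∀ σ A → pos (sub σ A) ≡ sub σ (pos A)
pos-sub σ (t ≐ u)        = refl
pos-sub σ ⊤'             = refl
pos-sub σ ⊥'             = refl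
pos-sub σ (A ∧' B)       = cong₂ _∧'_ (pos-sub σ A) (pos-sub σ B)
pos-sub σ (A ∨' B)       = cong₂ _∨'_ (pos-sub σ A) (pos-sub σ B)
pos-sub σ (∃' A)         = cong ∃' (pos-sub (lift σ) A)
pos-sub σ (∀[ k ] A ⊃ B) = refl

PosEx-pos : ∀ A → PosEx (pos A)
PosEx-pos (t ≐ u)        = atom (eq t u)
PosEx-pos ⊤'             = atom top
PosEx-pos ⊥'             = atom bot
PosEx-pos (A ∧' B)       = and (PosEx-pos A) (PosEx-pos B)
PosEx-pos (A ∨' B)       = or (PosEx-pos A) (PosEx-pos B)
PosEx-pos (∃' A)         = ex (PosEx-pos A)
PosEx-pos (∀[ k ] A ⊃ B) = atom top

pos-identity : PosEx A → pos A ≡ A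
pos-identity (atom (eq t u)) = refl
pos-identity (atom top)      = refl
pos-identity (atom bot)      = refl
pos-identity (and p q)       = cong₂ _∧'_ (pos-identity p) (pos-identity q)
pos-identity (or p q)        = cong₂ _∨'_ (pos-identity p) (pos-identity q)
pos-identity (ex p)          = cong ∃' (pos-identity p)

PosEx-sub : ∀ σ → PosEx A → PosEx (sub σ A)
PosEx-sub σ (atom (eq t u)) = atom (eq _ _)
PosEx-sub σ (atom top)      = atom top
PosEx-sub σ (atom bot)      = atom bot
PosEx-sub σ (and p q)       = and (PosEx-sub σ p) (PosEx-sub σ q)
PosEx-sub σ (or p q)        = or (PosEx-sub σ p) (PosEx-sub σ q)
PosEx-sub σ (ex p)          = ex (PosEx-sub (lift σ) p)

FreeIn-pos : ∀ A → FreeIn i (pos A) → FreeIn i A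
FreeIn-pos (t ≐ u)  h        = h
FreeIn-pos (A ∧' B) (inj₁ h) = inj₁ (FreeIn-pos A h)
FreeIn-pos (A ∧' B) (inj₂ h) = inj₂ (FreeIn-pos B h)
FreeIn-pos (A ∨' B) (inj₁ h) = inj₁ (FreeIn-pos A h)
FreeIn-pos (A ∨' B) (inj₂ h) = inj₂ (FreeIn-pos B h)
FreeIn-pos (∃' A)   h        = FreeIn-pos A h

OccT-substT : ∀ σ t → OccT j (substT σ t) → Σ ℕ λ i → OccT i t × OccT j (σ i)
OccT-substT σ (var i)  o        = i , refl , o
OccT-substT σ (`S t)   o        = OccT-substT σ t o
OccT-substT σ (t `+ u) (inj₁ o) = let i , a , b = OccT-substT σ t o in i , inj₁ a , b
OccT-substT σ (t `+ u) (inj₂ o) = let i , a , b = OccT-substT σ u o in i , inj₂ a , b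
OccT-substT σ (t `· u) (inj₁ o) = let i , a , b = OccT-substT σ t o in i , inj₁ a , b
OccT-substT σ (t `· u) (inj₂ o) = let i , a , b = OccT-substT σ u o in i , inj₂ a , b

OccT-shT : ∀ t → OccT (suc j) (shT t) → OccT j t
OccT-shT t o with OccT-substT _ t o
... | i , occ , refl = occ

FreeIn-sub : ∀ σ → PosEx A → FreeIn j (sub σ A) → Σ ℕ λ i → FreeIn i A × OccT j (σ i)
FreeIn-sub σ (atom (eq t u)) (inj₁ o) = let i , a , b = OccT-substT σ t o in i , inj₁ a , b
FreeIn-sub σ (atom (eq t u)) (inj₂ o) = let i , a , b = OccT-substT σ u o in i , inj₂ a , b
FreeIn-sub σ (and p q) (inj₁ h) = let i , a , b = FreeIn-sub σ p h in i , inj₁ a , b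
FreeIn-sub σ (and p q) (inj₂ h) = let i , a , b = FreeIn-sub σ q h in i , inj₂ a , b
FreeIn-sub σ (or p q)  (inj₁ h) = let i , a , b = FreeIn-sub σ p h in i , inj₁ a , b
FreeIn-sub σ (or p q)  (inj₂ h) = let i , a , b = FreeIn-sub σ q h in i , inj₂ a , b
FreeIn-sub σ (ex p) h with FreeIn-sub (lift σ) p h
... | suc i , a , b = i , a , OccT-shT (σ i) b

FreeIn-wk : PosEx A → FreeIn (suc j) (wk A) → FreeIn j A
FreeIn-wk p h with FreeIn-sub _ p h
... | i , a , refl = a

Positive : (Fm → Fm → Set) → Set
Positive Ax = ∀ {C D} → Ax C D → pos C ≡ C × pos D ≡ D

^∃-positive : ∀ Γ → Positive (Γ ^∃)
^∃-positive Γ (A , B , _ , refl , refl) = pos-identity (PosEx-pos A) , pos-identity (PosEx-pos B)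

module _ {Ax : Fm → Fm → Set} (positive : Positive Ax) where

  ⊢-pos : Ax ⊢ A ⇒ B → Ax ⊢ pos A ⇒ pos B
  ⊢-pos (ax g) = let eC , eD = positive g in ax (subst₂ Ax (sym eC) (sym eD) g)
  ⊢-pos idA    = idA
  ⊢-pos topA   = topA
  ⊢-pos botA   = botA
  ⊢-pos distA  = distA
  ⊢-pos (∃distA {A} {B}) =
    subst (λ X → Ax ⊢ pos A ∧' ∃' (pos B) ⇒ ∃' (X ∧' pos B)) (sym (pos-sub _ A)) ∃distA
  ⊢-pos (eqRefl i) = eqRefl i
  ⊢-pos (eqSub i j (eq t u)) = eqSub i j (eq t u)
  ⊢-pos (eqSub i j top)      = eqSub i j top
  ⊢-pos (eqSub i j bot)      = eqSub i j bot
  ⊢-pos ∀trans               = topA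
  ⊢-pos ∀conj                = topA
  ⊢-pos ∀disj                = topA
  ⊢-pos (∀subst _ _)         = topA
  ⊢-pos (∀rename _ _ _ _)    = topA
  ⊢-pos ∀∃                   = topA
  ⊢-pos (cut d e) = cut (⊢-pos d) (⊢-pos e)
  ⊢-pos (∧I d e)  = ∧I (⊢-pos d) (⊢-pos e)
  ⊢-pos (∧E₁ d)   = ∧E₁ (⊢-pos d)
  ⊢-pos (∧E₂ d)   = ∧E₂ (⊢-pos d)
  ⊢-pos (∨E d e)  = ∨E (⊢-pos d) (⊢-pos e)
  ⊢-pos (∨I₁ d)   = ∨I₁ (⊢-pos d)
  ⊢-pos (∨I₂ d)   = ∨I₂ (⊢-pos d)
  ⊢-pos (substR {A} {B} σ d) =
    subst₂ (Ax ⊢_⇒_) (sym (pos-sub σ A)) (sym (pos-sub σ B)) (substR σ (⊢-pos d))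
  ⊢-pos (∃L {A} {B} d)  = ∃L (subst (Ax ⊢ pos B ⇒_) (pos-sub _ A) (⊢-pos d))
  ⊢-pos (∃L⁻ {A} {B} d) = subst (Ax ⊢ pos B ⇒_) (sym (pos-sub _ A)) (∃L⁻ (⊢-pos d))
  ⊢-pos (→I d)          = topA
  ⊢-pos (sNeq0 i)       = sNeq0 i
  ⊢-pos (sInj i j)      = sInj i j
  ⊢-pos (plus0 i)       = plus0 i
  ⊢-pos (plusS i j)     = plusS i j
  ⊢-pos (times0 i)      = times0 i
  ⊢-pos (timesS i j)    = timesS i j
  ⊢-pos indAx           = topA
  ⊢-pos (indR i {A} d)  =
    subst (Ax ⊢_⇒ pos A) (sym (pos-sub _ A)) (indR i (subst (Ax ⊢ pos A ⇒_) (pos-sub _ A) (⊢-pos d)))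

evalSub : Env → Sub → Env
evalSub ρ σ i = evalT ρ (σ i)

evalT-substT : ∀ ρ σ t → evalT ρ (substT σ t) ≡ evalT (evalSub ρ σ) t
evalT-substT ρ σ (var i)  = refl
evalT-substT ρ σ `0       = refl
evalT-substT ρ σ (`S t)   = cong suc (evalT-substT ρ σ t)
evalT-substT ρ σ (t `+ u) = cong₂ _+_ (evalT-substT ρ σ t) (evalT-substT ρ σ u)
evalT-substT ρ σ (t `· u) = cong₂ _*_ (evalT-substT ρ σ t) (evalT-substT ρ σ u)

evalSub-lift : ∀ ρ σ x → evalSub (x ∷ₑ ρ) (lift σ) ≗ x ∷ₑ evalSub ρ σ
evalSub-lift ρ σ x zero    = refl
evalSub-lift ρ σ x (suc i) = evalT-substT (x ∷ₑ ρ) _ (σ i)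

evalT-cong : ∀ t → (∀ {i} → OccT i t → ρ i ≡ ρ' i) → evalT ρ t ≡ evalT ρ' t
evalT-cong (var i)  h = h refl
evalT-cong `0       h = refl
evalT-cong (`S t)   h = cong suc (evalT-cong t h)
evalT-cong (t `+ u) h = cong₂ _+_ (evalT-cong t (λ o → h (inj₁ o))) (evalT-cong u (λ o → h (inj₂ o)))
evalT-cong (t `· u) h = cong₂ _*_ (evalT-cong t (λ o → h (inj₁ o))) (evalT-cong u (λ o → h (inj₂ o)))

Sat-cong : PosEx A → (∀ {i} → FreeIn i A → ρ i ≡ ρ' i) → Sat ρ A → Sat ρ' A
Sat-cong (atom (eq t u)) h s =
  trans (sym (evalT-cong t (λ o → h (inj₁ o)))) (trans s (evalT-cong u (λ o → h (inj₂ o))))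
Sat-cong (atom top) h s = tt
Sat-cong (atom bot) h s = s
Sat-cong (and p q) h (a , b) = Sat-cong p (λ o → h (inj₁ o)) a , Sat-cong q (λ o → h (inj₂ o)) b
Sat-cong (or p q) h = ¬¬-map (Sum.map (Sat-cong p (λ o → h (inj₁ o))) (Sat-cong q (λ o → h (inj₂ o))))
Sat-cong {A = ∃' A} {ρ = ρ} {ρ'} (ex p) h = ¬¬-map λ (x , s) → x , Sat-cong p (∷ₑ-cong x) s
  where
  ∷ₑ-cong : ∀ x {i} → FreeIn i A → (x ∷ₑ ρ) i ≡ (x ∷ₑ ρ') i
  ∷ₑ-cong x {zero}  _ = refl
  ∷ₑ-cong x {suc i} o = h o

Sat-ext : PosEx A → ρ ≗ ρ' → Sat ρ A → Sat ρ' A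
Sat-ext p ρ≗ρ' = Sat-cong p (λ {i} _ → ρ≗ρ' i)

Sat-sub⁺ : PosEx A → Sat (evalSub ρ σ) A → Sat ρ (sub σ A)
Sat-sub⁺ {ρ = ρ} {σ} (atom (eq t u)) s = trans (evalT-substT ρ σ t) (trans s (sym (evalT-substT ρ σ u)))
Sat-sub⁺ (atom top) s = tt
Sat-sub⁺ (atom bot) s = s
Sat-sub⁺ (and p q) (a , b) = Sat-sub⁺ p a , Sat-sub⁺ q b
Sat-sub⁺ (or p q) = ¬¬-map (Sum.map (Sat-sub⁺ p) (Sat-sub⁺ q))
Sat-sub⁺ {ρ = ρ} {σ} (ex p) =
  ¬¬-map λ (x , s) → x , Sat-sub⁺ p (Sat-ext p (λ i → sym (evalSub-lift ρ σ x i)) s)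

Sat-sub⁻ : PosEx A → Sat ρ (sub σ A) → Sat (evalSub ρ σ) A
Sat-sub⁻ {ρ = ρ} {σ} (atom (eq t u)) s = trans (sym (evalT-substT ρ σ t)) (trans s (evalT-substT ρ σ u))
Sat-sub⁻ (atom top) s = tt
Sat-sub⁻ (atom bot) s = s
Sat-sub⁻ (and p q) (a , b) = Sat-sub⁻ p a , Sat-sub⁻ q b
Sat-sub⁻ (or p q) = ¬¬-map (Sum.map (Sat-sub⁻ p) (Sat-sub⁻ q))
Sat-sub⁻ {ρ = ρ} {σ} (ex p) =
  ¬¬-map λ (x , s) → x , Sat-ext p (evalSub-lift ρ σ x) (Sat-sub⁻ p s)

Sat-stable : PosEx A → Stable (Sat ρ A)
Sat-stable {ρ = ρ} (atom (eq t u)) = decidable-stable (evalT ρ t ≟ evalT ρ u)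
Sat-stable (atom top) _  = tt
Sat-stable (atom bot) ¬¬s = ¬¬s id
Sat-stable (and p q) ¬¬s = Sat-stable p (¬¬-map proj₁ ¬¬s) , Sat-stable q (¬¬-map proj₂ ¬¬s)
Sat-stable (or p q) ¬¬s ¬s = ¬¬s (λ s → s ¬s)
Sat-stable (ex p) ¬¬s ¬s = ¬¬s (λ s → s ¬s)

Sat-pos : ∀ A → Sat ρ A → Sat ρ (pos A)
Sat-pos (t ≐ u)  s       = s
Sat-pos ⊤'       s       = s
Sat-pos ⊥'       s       = s
Sat-pos (A ∧' B) (a , b) = Sat-pos A a , Sat-pos B b
Sat-pos (A ∨' B)         = ¬¬-map (Sum.map (Sat-pos A) (Sat-pos B))
Sat-pos (∃' A)           = ¬¬-map λ (x , s) → x , Sat-pos A s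
Sat-pos (∀[ k ] A ⊃ B) _ = tt

Sat-pos-sub⁺ : ∀ A → Sat (evalSub ρ σ) (pos A) → Sat ρ (pos (sub σ A))
Sat-pos-sub⁺ {ρ = ρ} {σ} A s = subst (Sat ρ) (sym (pos-sub σ A)) (Sat-sub⁺ (PosEx-pos A) s)

Sat-pos-sub⁻ : ∀ A → Sat ρ (pos (sub σ A)) → Sat (evalSub ρ σ) (pos A)
Sat-pos-sub⁻ {ρ = ρ} {σ} A s = Sat-sub⁻ (PosEx-pos A) (subst (Sat ρ) (pos-sub σ A) s)

upd : Env → ℕ → ℕ → Env
upd ρ i a j = if j ≡ᵇ i then a else ρ j

evalSub-single : ∀ ρ i t → evalSub ρ (single i t) ≗ upd ρ i (evalT ρ t)
evalSub-single ρ i t j with j ≡ᵇ i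
... | true  = refl
... | false = refl

upd-same : ∀ ρ i a → upd ρ i a i ≡ a
upd-same ρ i a with i ≡ᵇ i | ≡⇒≡ᵇ i i refl
... | true  | _  = refl

upd-overwrite : ∀ ρ i a b → upd (upd ρ i a) i b ≗ upd ρ i b
upd-overwrite ρ i a b j with j ≡ᵇ i
... | true  = refl
... | false = refl

upd-self : ∀ ρ i → upd ρ i (ρ i) ≗ ρ
upd-self ρ i j with j ≡ᵇ i in e
... | true  = cong ρ (sym (≡ᵇ⇒≡ j i (subst T (sym e) tt)))
... | false = refl

evalSub-single-var : ∀ ρ i j → ρ i ≡ ρ j → evalSub ρ (single i (var j)) ≗ ρ
evalSub-single-var ρ i j e k =
  trans (evalSub-single ρ i (var j) k) (trans (cong (λ a → upd ρ i a k) (sym e)) (upd-self ρ i k))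

evalSub-single-S : ∀ ρ i a → evalSub (upd ρ i a) (single i (`S (var i))) ≗ upd ρ i (suc a)
evalSub-single-S ρ i a k = begin
  evalSub (upd ρ i a) (single i (`S (var i))) k  ≡⟨ evalSub-single (upd ρ i a) i (`S (var i)) k ⟩
  upd (upd ρ i a) i (suc (upd ρ i a i)) k        ≡⟨ cong (λ b → upd (upd ρ i a) i (suc b) k) (upd-same ρ i a) ⟩
  upd (upd ρ i a) i (suc a) k                    ≡⟨ upd-overwrite ρ i a (suc a) k ⟩
  upd ρ i (suc a) k                              ∎
  where open ≡-Reasoning

extV-length : (a : Vec ℕ n) → ∀ ρ → extV a ρ n ≡ ρ 0
extV-length []      ρ = refl
extV-length (x ∷ a) ρ = extV-length a ρ

extV-suc-length : (a : Vec ℕ n) → ∀ ρ → extV a ρ (suc n) ≡ ρ 1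
extV-suc-length []      ρ = refl
extV-suc-length (x ∷ a) ρ = extV-suc-length a ρ

extV-below : (a : Vec ℕ n) → ∀ ρ ρ' → j < n → extV a ρ j ≡ extV a ρ' j
extV-below {j = zero}  (x ∷ a) ρ ρ' _         = refl
extV-below {j = suc j} (x ∷ a) ρ ρ' (s≤s j<n) = extV-below a ρ ρ' j<n

unique-value : PosEx B → (∀ i → FreeIn i B → i ≤ n) →
  (∀ ρ → Sat ρ (sub (uSub n) B) → Sat ρ (sub (uSub (suc n)) B) → ρ n ≡ ρ (suc n)) →
  ∀ (a : Vec ℕ n) {b c ρ} → Sat (extV (b ∷ a) ρ) B → Sat (extV (c ∷ a) ρ) B → b ≡ c
unique-value {B} {n} p fv unique a {b} {c} {ρ} sb sc = begin
  b         ≡⟨ sym (extV-length a _) ⟩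
  ρᵤ n      ≡⟨ unique ρᵤ (at n (sym (extV-length a _)) sb) (at (suc n) (sym (extV-suc-length a _)) sc) ⟩
  ρᵤ (suc n) ≡⟨ extV-suc-length a _ ⟩
  c         ∎
  where
  open ≡-Reasoning
  ρᵤ : Env
  ρᵤ = extV a (b ∷ₑ (c ∷ₑ ρ))
  at : ∀ w {d} → d ≡ ρᵤ w → Sat (extV (d ∷ a) ρ) B → Sat ρᵤ (sub (uSub w) B)
  at w {d} d≡ρᵤw s = Sat-sub⁺ p (Sat-cong p agree s)
    where
    agree : ∀ {i} → FreeIn i B → (d ∷ₑ extV a ρ) i ≡ evalSub ρᵤ (uSub w) i
    agree {zero}  _ = d≡ρᵤw
    agree {suc j} h = extV-below a _ _ (fv (suc j) h)

data QF : Fm → Set where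
  atom : Atomic A → QF A
  and  : QF A → QF B → QF (A ∧' B)
  or   : QF A → QF B → QF (A ∨' B)

data Prenex : Fm → Set where
  qf : QF A → Prenex A
  ex : Prenex A → Prenex (∃' A)

QF-sub : ∀ σ → QF A → QF (sub σ A)
QF-sub σ (atom (eq t u)) = atom (eq _ _)
QF-sub σ (atom top)      = atom top
QF-sub σ (atom bot)      = atom bot
QF-sub σ (and p q)       = and (QF-sub σ p) (QF-sub σ q)
QF-sub σ (or p q)        = or (QF-sub σ p) (QF-sub σ q)

Prenex-sub : ∀ σ → Prenex A → Prenex (sub σ A)
Prenex-sub σ (qf q) = qf (QF-sub σ q)
Prenex-sub σ (ex p) = ex (Prenex-sub (lift σ) p)

QF-PosEx : QF A → PosEx A
QF-PosEx (atom a)  = atom a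
QF-PosEx (and p q) = and (QF-PosEx p) (QF-PosEx q)
QF-PosEx (or p q)  = or (QF-PosEx p) (QF-PosEx q)

Prenex-PosEx : Prenex A → PosEx A
Prenex-PosEx (qf q) = QF-PosEx q
Prenex-PosEx (ex p) = ex (Prenex-PosEx p)

QF-Δ₀ : QF A → Δ₀ A
QF-Δ₀ (atom a)  = atom a
QF-Δ₀ (and p q) = and (QF-Δ₀ p) (QF-Δ₀ q)
QF-Δ₀ (or p q)  = or (QF-Δ₀ p) (QF-Δ₀ q)

Prenex-Σ₁ : Prenex A → Σ₁ A
Prenex-Σ₁ (qf q) = 0 , _ , QF-Δ₀ q , refl
Prenex-Σ₁ (ex p) = let k , B , δ , e = Prenex-Σ₁ p in suc k , B , δ , cong ∃' e

data Connective : Set where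
  ∧ᶜ ∨ᶜ : Connective

_⟨_⟩_ : Fm → Connective → Fm → Fm
A ⟨ ∧ᶜ ⟩ B = A ∧' B
A ⟨ ∨ᶜ ⟩ B = A ∨' B

QF-⟨⟩ : ∀ c → QF A → QF B → QF (A ⟨ c ⟩ B)
QF-⟨⟩ ∧ᶜ = and
QF-⟨⟩ ∨ᶜ = or

FreeIn-⟨⟩-map : ∀ c → (FreeIn i A → FreeIn j C) → (FreeIn i B → FreeIn j D) →
                FreeIn i (A ⟨ c ⟩ B) → FreeIn j (C ⟨ c ⟩ D)
FreeIn-⟨⟩-map ∧ᶜ f g = Sum.map f g
FreeIn-⟨⟩-map ∨ᶜ f g = Sum.map f g

module PrenexNormalForm (Ax : Fm → Fm → Set) where

  infix 4 _⊣⊢_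
  _⊣⊢_ : Fm → Fm → Set
  A ⊣⊢ B = (Ax ⊢ A ⇒ B) × (Ax ⊢ B ⇒ A)

  ⊣⊢-trans : A ⊣⊢ B → B ⊣⊢ C → A ⊣⊢ C
  ⊣⊢-trans (d₁ , e₁) (d₂ , e₂) = cut d₁ d₂ , cut e₂ e₁

  ∃-intro : Ax ⊢ E ⇒ wk (∃' E)
  ∃-intro = ∃L⁻ idA

  ∃-mono : Ax ⊢ A ⇒ B → Ax ⊢ ∃' A ⇒ ∃' B
  ∃-mono d = ∃L (cut d ∃-intro)

  ∃-cong : A ⊣⊢ B → ∃' A ⊣⊢ ∃' B
  ∃-cong (d , e) = ∃-mono d , ∃-mono e

  ∃-vacuous : Ax ⊢ R ⇒ ∃' (wk R)
  ∃-vacuous = cut (∧I idA (cut topA (∃-intro {E = ⊤'}))) (cut ∃distA (∃-mono (∧E₁ idA)))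

  ∧-comm : Ax ⊢ A ∧' B ⇒ B ∧' A
  ∧-comm = ∧I (∧E₂ idA) (∧E₁ idA)

  ⟨⟩-mono : ∀ c → Ax ⊢ A ⇒ C → Ax ⊢ B ⇒ D → Ax ⊢ A ⟨ c ⟩ B ⇒ C ⟨ c ⟩ D
  ⟨⟩-mono ∧ᶜ d e = ∧I (cut (∧E₁ idA) d) (cut (∧E₂ idA) e)
  ⟨⟩-mono ∨ᶜ d e = ∨E (cut d (∨I₁ idA)) (cut e (∨I₂ idA))

  ⟨⟩-cong : ∀ c → A ⊣⊢ C → B ⊣⊢ D → A ⟨ c ⟩ B ⊣⊢ C ⟨ c ⟩ D
  ⟨⟩-cong c (d₁ , e₁) (d₂ , e₂) = ⟨⟩-mono c d₁ d₂ , ⟨⟩-mono c e₁ e₂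

  pull-∃ˡ : ∀ c → ∃' E ⟨ c ⟩ R ⊣⊢ ∃' (E ⟨ c ⟩ wk R)
  pull-∃ˡ ∧ᶜ = cut ∧-comm (cut ∃distA (∃-mono ∧-comm)) , ∃L (∧I (cut (∧E₁ idA) ∃-intro) (∧E₂ idA))
  pull-∃ˡ ∨ᶜ = ∨E (∃-mono (∨I₁ idA)) (cut ∃-vacuous (∃-mono (∨I₂ idA))) ,
               ∃L (∨E (cut ∃-intro (∨I₁ idA)) (∨I₂ idA))

  pull-∃ʳ : ∀ c → R ⟨ c ⟩ ∃' E ⊣⊢ ∃' (wk R ⟨ c ⟩ E)
  pull-∃ʳ ∧ᶜ = ∃distA , ∃L (∧I (∧E₁ idA) (cut (∧E₂ idA) ∃-intro))
  pull-∃ʳ ∨ᶜ = ∨E (cut ∃-vacuous (∃-mono (∨I₁ idA))) (∃-mono (∨I₂ idA)) ,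
               ∃L (∨E (∨I₁ idA) (cut ∃-intro (∨I₂ idA)))

  record PrenexNF (P : Fm) : Set where
    constructor prenexNF
    field
      {nf}   : Fm
      prenex : Prenex nf
      equiv  : P ⊣⊢ nf
      fv-⊆   : ∀ {i} → FreeIn i nf → FreeIn i P

  PrenexNF-refl : Prenex P → PrenexNF P
  PrenexNF-refl p = prenexNF p (idA , idA) id

  PrenexNF-transport : P ⊣⊢ R → (∀ {i} → FreeIn i R → FreeIn i P) → PrenexNF R → PrenexNF P
  PrenexNF-transport P⊣⊢R fv (prenexNF p e fv′) = prenexNF p (⊣⊢-trans P⊣⊢R e) (λ h → fv (fv′ h))

  PrenexNF-∃ : PrenexNF P → PrenexNF (∃' P)
  PrenexNF-∃ (prenexNF p e fv) = prenexNF (ex p) (∃-cong e) fv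

  prenex-⟨⟩ʳ : ∀ c → QF A → Prenex B → PrenexNF (A ⟨ c ⟩ B)
  prenex-⟨⟩ʳ c q (qf q′) = PrenexNF-refl (qf (QF-⟨⟩ c q q′))
  prenex-⟨⟩ʳ c q (ex p)  = PrenexNF-transport (pull-∃ʳ c) (FreeIn-⟨⟩-map c (FreeIn-wk (QF-PosEx q)) id)
                             (PrenexNF-∃ (prenex-⟨⟩ʳ c (QF-sub _ q) p))

  prenex-⟨⟩ : ∀ c → Prenex A → Prenex B → PrenexNF (A ⟨ c ⟩ B)
  prenex-⟨⟩ c (qf q) p′ = prenex-⟨⟩ʳ c q p′
  prenex-⟨⟩ c (ex p) p′ = PrenexNF-transport (pull-∃ˡ c) (FreeIn-⟨⟩-map c id (FreeIn-wk (Prenex-PosEx p′)))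
                            (PrenexNF-∃ (prenex-⟨⟩ c p (Prenex-sub _ p′)))

  PrenexNF-⟨⟩ : ∀ c → PrenexNF A → PrenexNF B → PrenexNF (A ⟨ c ⟩ B)
  PrenexNF-⟨⟩ c (prenexNF p e fv) (prenexNF p′ e′ fv′) =
    PrenexNF-transport (⟨⟩-cong c e e′) (FreeIn-⟨⟩-map c fv fv′) (prenex-⟨⟩ c p p′)

  prenex-normal-form : PosEx P → PrenexNF P
  prenex-normal-form (atom a)  = PrenexNF-refl (qf (atom a))
  prenex-normal-form (and p q) = PrenexNF-⟨⟩ ∧ᶜ (prenex-normal-form p) (prenex-normal-form q)
  prenex-normal-form (or p q)  = PrenexNF-⟨⟩ ∨ᶜ (prenex-normal-form p) (prenex-normal-form q)
  prenex-normal-form (ex p)    = PrenexNF-∃ (prenex-normal-form p)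

module PositiveExtension {Ax : Fm → Fm → Set} (positive : Positive Ax) (ℕ⊨Ax : ℕ⊨ Ax) where

  open PrenexNormalForm Ax

  -- Only positive parts are interpreted, so every rule about ∀ holds
  -- trivially; as Sat reads ∨ and ∃ double-negated, their eliminations
  -- rely on Sat-stable.
  sound : Ax ⊢ A ⇒ B → ∀ ρ → Sat ρ (pos A) → Sat ρ (pos B)
  sound (ax g) ρ s = let eC , eD = positive g in
    subst (Sat ρ) (sym eD) (ℕ⊨Ax _ _ g ρ (subst (Sat ρ) eC s))
  sound idA                 ρ s = s
  sound topA                ρ s = tt
  sound botA                ρ ()
  sound distA               ρ (a , ¬¬bc) = ¬¬-map (Sum.map (a ,_) (a ,_)) ¬¬bc
  sound (∃distA {A})        ρ (a , ¬¬e) = ¬¬-map (λ (x , b) → x , Sat-pos-sub⁺ A a , b) ¬¬e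
  sound (eqRefl i)          ρ _ = refl
  sound (eqSub i j (eq t u)) ρ (e , s) =
    Sat-sub⁺ (atom (eq t u)) (Sat-ext (atom (eq t u)) (λ k → sym (evalSub-single-var ρ i j e k)) s)
  sound (eqSub i j top)     ρ _ = tt
  sound (eqSub i j bot)     ρ (_ , ())
  sound ∀trans              ρ _ = tt
  sound ∀conj               ρ _ = tt
  sound ∀disj               ρ _ = tt
  sound (∀subst _ _)        ρ _ = tt
  sound (∀rename _ _ _ _)   ρ _ = tt
  sound ∀∃                  ρ _ = tt
  sound (cut d e)           ρ s = sound e ρ (sound d ρ s)
  sound (∧I d e)            ρ s = sound d ρ s , sound e ρ s
  sound (∧E₁ d)             ρ s = proj₁ (sound d ρ s)
  sound (∧E₂ d)             ρ s = proj₂ (sound d ρ s)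
  sound (∨E {A} d e)        ρ ¬¬s =
    Sat-stable (PosEx-pos A) (¬¬-map [ sound d ρ , sound e ρ ]′ ¬¬s)
  sound (∨I₁ d)             ρ s = sound d ρ (λ ¬s → ¬s (inj₁ s))
  sound (∨I₂ d)             ρ s = sound d ρ (λ ¬s → ¬s (inj₂ s))
  sound (substR {A} {B} σ d) ρ s = Sat-pos-sub⁺ B (sound d _ (Sat-pos-sub⁻ A s))
  sound (∃L {A} d)          ρ ¬¬s =
    Sat-stable (PosEx-pos A) (¬¬-map (λ (x , s) → Sat-pos-sub⁻ A (sound d (x ∷ₑ ρ) s)) ¬¬s)
  sound (∃L⁻ {A} {B} d)     ρ s = Sat-pos-sub⁺ A (sound d (λ i → ρ (suc i)) λ ¬s →
    ¬s (ρ 0 , Sat-ext (PosEx-pos B) (λ { zero → refl ; (suc i) → refl }) s))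
  sound (→I d)              ρ _ = tt
  sound (sNeq0 i)           ρ ()
  sound (sInj i j)          ρ s = suc-injective s
  sound (plus0 i)           ρ _ = +-identityʳ (ρ i)
  sound (plusS i j)         ρ _ = +-suc (ρ i) (ρ j)
  sound (times0 i)          ρ _ = *-zeroʳ (ρ i)
  sound (timesS i j)        ρ _ = trans (*-suc (ρ i) (ρ j)) (+-comm (ρ i) (ρ i * ρ j))
  sound indAx               ρ _ = tt
  sound (indR i {A} d)      ρ s = Sat-ext (PosEx-pos A) (upd-self ρ i) (induct (ρ i))
    where
    induct : ∀ a → Sat (upd ρ i a) (pos A)
    induct zero    = Sat-ext (PosEx-pos A) (evalSub-single ρ i `0) (Sat-pos-sub⁻ A s)
    induct (suc a) = Sat-ext (PosEx-pos A) (evalSub-single-S ρ i a)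
                       (Sat-pos-sub⁻ A (sound d (upd ρ i a) (induct a)))

  defines-PosEx : ∀ {n f} → PosEx B → (∀ i → FreeIn i B → i ≤ n) →
    (∀ a ρ → Sat (extV (f a ∷ a) ρ) B) →
    Ax ⊢ ⊤' ⇒ ∃' B →
    Ax ⊢ sub (uSub n) B ∧' sub (uSub (suc n)) B ⇒ var n ≐ var (suc n) →
    Defines Ax n f B
  defines-PosEx {B} {n} {f} p fv graph existence uniqueness =
    fv , (λ a b ρ → unique-value p fv unique-in-ℕ a (graph a ρ) , λ { refl → graph a ρ }) ,
    existence , uniqueness
    where
    unique-in-ℕ : ∀ ρ → Sat ρ (sub (uSub n) B) → Sat ρ (sub (uSub (suc n)) B) → ρ n ≡ ρ (suc n)
    unique-in-ℕ ρ u v =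
      sound uniqueness ρ (subst (Sat ρ) (sym (pos-identity (and (PosEx-sub _ p) (PosEx-sub _ p)))) (u , v))

  Defines-pos : ∀ {n f} → Defines Ax n f A → Defines Ax n f (pos A)
  Defines-pos {A} {n} {f} (fv , inℕ , existence , uniqueness) =
    defines-PosEx (PosEx-pos A) (λ i h → fv i (FreeIn-pos A h))
      (λ a ρ → Sat-pos A (proj₂ (inℕ a (f a) ρ) refl))
      (⊢-pos positive existence)
      (subst (Ax ⊢_⇒ var n ≐ var (suc n)) (cong₂ _∧'_ (pos-sub (uSub n) A) (pos-sub (uSub (suc n)) A))
        (⊢-pos positive uniqueness))

  Defines-⊣⊢ : ∀ {n f} → PosEx P → PosEx R → P ⊣⊢ R → (∀ {i} → FreeIn i R → FreeIn i P) →
    Defines Ax n f P → Defines Ax n f R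
  Defines-⊣⊢ {P} {R} {n} {f} p r (P⇒R , R⇒P) fv⊆ (fv , inℕ , existence , uniqueness) =
    defines-PosEx r (λ i h → fv i (fv⊆ h)) graph (cut existence (∃-mono P⇒R))
      (cut (⟨⟩-mono ∧ᶜ (substR _ R⇒P) (substR _ R⇒P)) uniqueness)
    where
    graph : ∀ a ρ → Sat (extV (f a ∷ a) ρ) R
    graph a ρ = subst (Sat _) (pos-identity r)
      (sound P⇒R _ (subst (Sat _) (sym (pos-identity p)) (proj₂ (inℕ a (f a) ρ) refl)))

  PT⇒PR : ∀ {n f} → PT Ax n f → PR Ax n f
  PT⇒PR (A , d) =
    let prenexNF p e fv = prenex-normal-form (PosEx-pos A)
    in _ , Prenex-Σ₁ p , Defines-⊣⊢ (PosEx-pos A) (Prenex-PosEx p) e fv (Defines-pos d)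

theorem3p9 : (Γ : Fm → Fm → Set) → ℕ⊨ (Γ ^∃) →
    ((n : ℕ) (f : Vec ℕ n → ℕ) (A : Fm) → Defines (Γ ^∃) n f A →
      PosEx (pos A) × Defines (Γ ^∃) n f (pos A))
    × ((n : ℕ) (f : Vec ℕ n → ℕ) →
      (PT (Γ ^∃) n f → PR (Γ ^∃) n f) × (PR (Γ ^∃) n f → PT (Γ ^∃) n f))
theorem3p9 Γ ℕ⊨Γ^∃ =
  (λ n f A d → PosEx-pos A , Defines-pos d) ,
  (λ n f → PT⇒PR , λ (A , _ , d) → A , d)
  where open PositiveExtension (^∃-positive Γ) ℕ⊨Γ^∃
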